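{- Let $q,q',n$ be integers with $q'\ge 2q+1>4$ and $n>1$. Let $S$ be an $\mathcal{OS}_q(n)$ of period $m$ with ring sequence $[s_0,\ldots,s_{m-1}]$ where $s_0=0$. Let $S''$ be the periodic sequence over $\mathbb{Z}_{q'}$ with ring sequence $[s'_0,\ldots,s'_{m-1},-s'_0,\ldots,-s'_{m-1}]$. Let $t_i=(-1)^{i+m-1}s'_i$ if $s'_i\neq0$ and $t_i=(-1)^{i+m-1}q$ (in $\mathbb{Z}_{q'}$) if $s'_i=0$, for $i=0,\ldots,m-1$, and let $T'$ be the periodic sequence with ring sequence $[t_0,\ldots,t_{m-1},-t_0,\ldots,-t_{m-1}]$. Then $S''$ and $T'$ are special-orientable-disjoint.
   Context: For $x\in\mathbb{Z}_q$, $x'$ denotes the residue class in $\mathbb{Z}_{q'}$ of the unique integer in $\{0,\ldots,q-1\}$ representing $x$. A periodic sequence is described by its ring sequence (one period). Write $\mathbf{s}_n(i)=(s_i,\ldots,s_{i+n-1})$; for an $n$-tuple $\mathbf{u}$, $\mathbf{u}^R$ is its reverse and $-\mathbf{u}$ its entrywise negative. An $n$-window sequence of period $m$ is one where $\mathbf{s}_n(i)=\mathbf{s}_n(j)$ implies $i\equiv j\pmod m$. An $\mathcal{OS}_q(n)$ is an $n$-window sequence over $\mathbb{Z}_q$ with $\mathbf{s}_n(i)\neq\mathbf{s}_n(j)^R$ for all $i,j$. Two sequences $A=(a_i)$, $B=(b_i)$ are special-orientable-disjoint (s-disjoint) if for all $i,j$: $\mathbf{a}_n(i)\neq\mathbf{b}_n(j)$,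 $\mathbf{a}_n(i)\neq\mathbf{b}_n(j)^R$ and $\mathbf{a}_n(i)\neq-\mathbf{b}_n(j)^R$. -}

module Defs where

open import Data.Nat using (ℕ; zero; suc; _+_; _∸_; NonZero)
open import Data.Nat.DivMod using (_mod_; _%_)
open import Data.Fin using (Fin; toℕ; splitAt)
open import Data.Vec using (Vec; tabulate; reverse; map)
open import Data.Sum using (inj₁; inj₂)
open import Data.Product using (_×_)
open import Relation.Binary.PropositionalEquality using (_≡_; _≢_)
open import Relation.Nullary using (yes; no)
open import Data.Nat using (_≟_)

neg : ∀ {q} .{{_ : NonZero q}} → Fin q → Fin q
neg {q} x = (q ∸ toℕ x) mod q

-- x ↦ x' : residue in ℤ_{q'} of the representative of x in {0,…,q-1}
lift : ∀ {q} (q' : ℕ) .{{_ : NonZero q'}} → Fin q → Fin q'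
lift q' x = toℕ x mod q'

periodic : ∀ {A : Set} {L : ℕ} .{{_ : NonZero L}} → (Fin L → A) → ℕ → A
periodic {L = L} r i = r (i mod L)

window : ∀ {A : Set} → (ℕ → A) → (n : ℕ) → ℕ → Vec A n
window s n i = tabulate (λ k → s (i + toℕ k))

IsWindowSeq : ∀ {A : Set} → (ℕ → A) → (n m : ℕ) → .{{_ : NonZero m}} → Set
IsWindowSeq s n m = ∀ i j → window s n i ≡ window s n j → i % m ≡ j % m

IsOS : (q n m : ℕ) → .{{_ : NonZero m}} → (Fin m → Fin q) → Set
IsOS q n m r =
  IsWindowSeq (periodic r) n m ×
  (∀ i j → window (periodic r) n i ≢ reverse (window (periodic r) n j))

SDisjoint : ∀ {q} .{{_ : NonZero q}} → (n : ℕ) → (ℕ → Fin q) → (ℕ → Fin q) → Set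
SDisjoint n a b = ∀ i j →
  (window a n i ≢ window b n j) ×
  (window a n i ≢ reverse (window b n j)) ×
  (window a n i ≢ map neg (reverse (window b n j)))

double-nonZero : ∀ m → .{{_ : NonZero m}} → NonZero (m + m)
double-nonZero (suc m) = _

ringNeg : ∀ {q m} .{{_ : NonZero q}} → (Fin m → Fin q) → Fin (m + m) → Fin q
ringNeg {m = m} f k with splitAt m k
... | inj₁ i = f i
... | inj₂ i = neg (f i)

periodicNeg : ∀ {q} .{{_ : NonZero q}} (m : ℕ) .{{_ : NonZero m}} → (Fin m → Fin q) → ℕ → Fin q
periodicNeg m f = periodic {{double-nonZero m}} (ringNeg f)

signPow : ∀ {q} .{{_ : NonZero q}} → ℕ → Fin q → Fin q
signPow e x with e % 2 ≟ 0
... | yes _ = x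
... | no _ = neg x

tSeq : ∀ {q} (q' m : ℕ) .{{_ : NonZero q'}} → (Fin m → Fin q) → Fin m → Fin q'
tSeq {q} q' m s i with toℕ (lift q' (s i)) ≟ 0
... | yes _ = signPow (toℕ i + m ∸ 1) (q mod q')
... | no _ = signPow (toℕ i + m ∸ 1) (lift q' (s i))

module Submission where

-- Every entry of S'' and T' is 0 or ±c with 1 ≤ c ≤ q, and since q' > 2q these signed values are
-- pairwise distinct. The fold v ↦ |v| mod q forgets the sign and sends q to 0, so it maps S'', T'
-- and −T' entrywise onto S: a window of S'' equal to a reversed window of T' or of −T' would fold
-- to a window of S equal to a reversed window of S, against orientability. A window of S'' equal
-- to a window of T' gives S''ᵢ = T'ⱼ and S''ᵢ₊₁ = T'ⱼ₊₁ with all four entries nonzero; as s₀ = 0,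
-- neither i nor j crosses a multiple of m, so the sign (-1)^⌊i/m⌋ of S'' stays the same while the
-- sign (-1)^(⌊j/m⌋ + j mod m + m − 1) of T' flips.

open import Defs
open import Data.Nat using (ℕ; _+_; _*_; _<_; _≤_; NonZero)
open import Data.Fin using (Fin; toℕ)
open import Relation.Binary.PropositionalEquality using (_≡_)

open import Data.Nat using (zero; suc; _∸_; _⊓_; _%_; _/_; _≟_; s≤s; z≤n; >-nonZero⁻¹)
open import Data.Nat.Properties
open import Data.Nat.DivMod
open import Data.Nat.Divisibility using (divides)
open import Data.Fin using (zero; suc; join; splitAt)
open import Data.Fin.Properties using (toℕ-injective; toℕ-fromℕ<; toℕ<n; toℕ-↑ˡ; toℕ-↑ʳ; splitAt-↑ˡ; splitAt-↑ʳ; join-splitAt)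
open import Data.Vec using (Vec; map; reverse; lookup)
open import Data.Vec.Properties using (lookup∘tabulate; tabulate-∘; tabulate-cong; map-∘; map-cong; map-reverse)
open import Data.Sum using (_⊎_; inj₁; inj₂)
open import Data.Product using (_×_; _,_; proj₁)
open import Data.Empty using (⊥)
open import Function using (_∘_)
open import Relation.Nullary using (yes; no; contradiction)
open import Relation.Binary.PropositionalEquality using (refl; sym; trans; cong; cong₂; subst; subst₂; _≢_; module ≡-Reasoning)

open ≡-Reasoning

toℕ-mod : ∀ a n .{{_ : NonZero n}} → toℕ (a mod n) ≡ a % n
toℕ-mod a n = toℕ-fromℕ< (m%n<n a n)

mod-toℕ : ∀ {n} .{{_ : NonZero n}} (x : Fin n) → toℕ x mod n ≡ x
mod-toℕ {n} x = toℕ-injective (trans (toℕ-mod (toℕ x) n) (m<n⇒m%n≡m (toℕ<n x)))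

suc-/-%≢0 : ∀ p m .{{_ : NonZero m}} → suc p % m ≢ 0 →
            suc p / m ≡ p / m × suc p % m ≡ suc (p % m)
suc-/-%≢0 p m ≢0 = quotient , remainder
  where
  r : ℕ
  r = p % m
  suc-p≡ : suc p ≡ suc r + p / m * m
  suc-p≡ = cong suc (m≡m%n+[m/n]*n p m)
  suc-p%m : suc p % m ≡ suc r % m
  suc-p%m = trans (%-congˡ suc-p≡) ([m+kn]%n≡m%n (suc r) (p / m) m)
  suc-r<m : suc r < m
  suc-r<m with m≤n⇒m<n∨m≡n (m%n<n p m)
  ... | inj₁ lt = lt
  ... | inj₂ eq = contradiction (trans suc-p%m (trans (%-congˡ eq) (n%n≡0 m))) ≢0
  remainder : suc p % m ≡ suc r
  remainder = trans suc-p%m (m<n⇒m%n≡m suc-r<m)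
  quotient : suc p / m ≡ p / m
  quotient = begin
    suc p / m                  ≡⟨ /-congˡ suc-p≡ ⟩
    (suc r + p / m * m) / m    ≡⟨ +-distrib-/-∣ʳ (suc r) (divides (p / m) refl) ⟩
    suc r / m + p / m * m / m  ≡⟨ cong₂ _+_ (m<n⇒m/n≡0 suc-r<m) (m*n/n≡m (p / m) m) ⟩
    p / m                      ∎

%2≢0⇒%2≡1 : ∀ e → e % 2 ≢ 0 → e % 2 ≡ 1
%2≢0⇒%2≡1 e ≢0 with e % 2 | m%n<n e 2
... | 0           | _            = contradiction refl ≢0
... | 1           | _            = refl
... | suc (suc _) | s≤s (s≤s ())

%2≢suc%2 : ∀ e → e % 2 ≢ suc e % 2
%2≢suc%2 zero ()
%2≢suc%2 (suc zero) ()
%2≢suc%2 (suc (suc e)) eq = %2≢suc%2 e (trans (sym (ss%2 e)) (trans eq (ss%2 (suc e))))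
  where
  ss%2 : ∀ k → suc (suc k) % 2 ≡ k % 2
  ss%2 k = trans (%-congˡ (+-comm 2 k)) ([m+n]%n≡m%n k 2)

module _ {n : ℕ} .{{_ : NonZero n}} where

  toℕ-neg-≡0 : (x : Fin n) → toℕ x ≡ 0 → toℕ (neg x) ≡ 0
  toℕ-neg-≡0 x x≡0 =
    trans (toℕ-mod (n ∸ toℕ x) n) (trans (%-congˡ (cong (n ∸_) x≡0)) (n%n≡0 n))

  toℕ-neg-≢0 : (x : Fin n) → toℕ x ≢ 0 → toℕ (neg x) ≡ n ∸ toℕ x
  toℕ-neg-≢0 x x≢0 = trans (toℕ-mod (n ∸ toℕ x) n)
    (m<n⇒m%n≡m (∸-monoʳ-< (n≢0⇒n>0 x≢0) (<⇒≤ (toℕ<n x))))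

  neg-involutive : (x : Fin n) → neg (neg x) ≡ x
  neg-involutive x with toℕ x ≟ 0
  ... | yes x≡0 = toℕ-injective (trans (toℕ-neg-≡0 (neg x) (toℕ-neg-≡0 x x≡0)) (sym x≡0))
  ... | no x≢0 = toℕ-injective (begin
    toℕ (neg (neg x))   ≡⟨ toℕ-neg-≢0 (neg x) -x≢0 ⟩
    n ∸ toℕ (neg x)     ≡⟨ cong (n ∸_) (toℕ-neg-≢0 x x≢0) ⟩
    n ∸ (n ∸ toℕ x)     ≡⟨ m∸[m∸n]≡n (<⇒≤ (toℕ<n x)) ⟩
    toℕ x               ∎)
    where
    -x≢0 : toℕ (neg x) ≢ 0
    -x≢0 = subst (_≢ 0) (sym (toℕ-neg-≢0 x x≢0)) (m>n⇒m∸n≢0 (toℕ<n x))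

  neg≢self : (x : Fin n) → toℕ x ≢ 0 → toℕ x + toℕ x < n → neg x ≢ x
  neg≢self x x≢0 x+x<n -x≡x = <⇒≢ x+x<n (begin
    toℕ x + toℕ x         ≡⟨ cong (_+ toℕ x) (trans (cong toℕ (sym -x≡x)) (toℕ-neg-≢0 x x≢0)) ⟩
    n ∸ toℕ x + toℕ x     ≡⟨ m∸n+n≡m (<⇒≤ (toℕ<n x)) ⟩
    n                     ∎)

  abs : Fin n → ℕ
  abs x = toℕ x ⊓ (n ∸ toℕ x)

  abs-neg : (x : Fin n) → abs (neg x) ≡ abs x
  abs-neg x with toℕ x ≟ 0
  ... | yes x≡0 = cong (λ k → k ⊓ (n ∸ k)) (trans (toℕ-neg-≡0 x x≡0) (sym x≡0))
  ... | no x≢0 = begin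
    toℕ (neg x) ⊓ (n ∸ toℕ (neg x))   ≡⟨ cong (λ k → k ⊓ (n ∸ k)) (toℕ-neg-≢0 x x≢0) ⟩
    (n ∸ toℕ x) ⊓ (n ∸ (n ∸ toℕ x))   ≡⟨ cong ((n ∸ toℕ x) ⊓_) (m∸[m∸n]≡n (<⇒≤ (toℕ<n x))) ⟩
    (n ∸ toℕ x) ⊓ toℕ x               ≡⟨ ⊓-comm (n ∸ toℕ x) (toℕ x) ⟩
    toℕ x ⊓ (n ∸ toℕ x)               ∎

  abs-mod : ∀ c → c + c < n → abs (c mod n) ≡ c
  abs-mod c c+c<n = begin
    toℕ (c mod n) ⊓ (n ∸ toℕ (c mod n))  ≡⟨ cong (λ k → k ⊓ (n ∸ k)) toℕ-c ⟩
    c ⊓ (n ∸ c)                          ≡⟨ m≤n⇒m⊓n≡m (m+n≤o⇒m≤o∸n c (<⇒≤ c+c<n)) ⟩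
    c                                    ∎
    where
    toℕ-c : toℕ (c mod n) ≡ c
    toℕ-c = trans (toℕ-mod c n) (m<n⇒m%n≡m (≤-<-trans (m≤m+n c c) c+c<n))

  signPow-suc : ∀ e (x : Fin n) → signPow (suc e) x ≡ neg (signPow e x)
  signPow-suc e x with e % 2 ≟ 0 | suc e % 2 ≟ 0
  ... | yes e≡0 | yes e+1≡0 = contradiction (trans e≡0 (sym e+1≡0)) (%2≢suc%2 e)
  ... | yes _   | no _      = refl
  ... | no _    | yes _     = sym (neg-involutive x)
  ... | no e≢0  | no e+1≢0  =
    contradiction (trans (%2≢0⇒%2≡1 e e≢0) (sym (%2≢0⇒%2≡1 (suc e) e+1≢0))) (%2≢suc%2 e)

  signPow-+ : ∀ a b (x : Fin n) → signPow (a + b) x ≡ signPow a (signPow b x)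
  signPow-+ zero b x = refl
  signPow-+ (suc a) b x = begin
    signPow (suc (a + b)) x         ≡⟨ signPow-suc (a + b) x ⟩
    neg (signPow (a + b) x)         ≡⟨ cong neg (signPow-+ a b x) ⟩
    neg (signPow a (signPow b x))   ≡⟨ signPow-suc a (signPow b x) ⟨
    signPow (suc a) (signPow b x)   ∎

  signPow-cong : ∀ a b (x : Fin n) → a % 2 ≡ b % 2 → signPow a x ≡ signPow b x
  signPow-cong a b x a≡b with a % 2 ≟ 0 | b % 2 ≟ 0
  ... | yes _   | yes _   = refl
  ... | no _    | no _    = refl
  ... | yes a≡0 | no b≢0  = contradiction (trans (sym a≡b) a≡0) b≢0
  ... | no a≢0  | yes b≡0 = contradiction (trans a≡b b≡0) a≢0

  signPow-parity : ∀ a b (x : Fin n) → neg x ≢ x → signPow a x ≡ signPow b x → a % 2 ≡ b % 2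
  signPow-parity a b x -x≢x eq with a % 2 ≟ 0 | b % 2 ≟ 0
  ... | yes a≡0 | yes b≡0 = trans a≡0 (sym b≡0)
  ... | no a≢0  | no b≢0  = trans (%2≢0⇒%2≡1 a a≢0) (sym (%2≢0⇒%2≡1 b b≢0))
  ... | yes _   | no _    = contradiction (sym eq) -x≢x
  ... | no _    | yes _   = contradiction eq -x≢x

  abs-signPow : ∀ e (x : Fin n) → abs (signPow e x) ≡ abs x
  abs-signPow e x with e % 2 ≟ 0
  ... | yes _ = refl
  ... | no _  = abs-neg x

module _ {n : ℕ} .{{_ : NonZero n}} (m : ℕ) .{{_ : NonZero m}} (f : Fin m → Fin n) where

  ringNeg-signPow : (k : Fin (m + m)) → ringNeg f k ≡ signPow (toℕ k / m) (f (toℕ k mod m))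
  ringNeg-signPow k = subst P (join-splitAt m m k) (on-join (splitAt m k))
    where
    P : Fin (m + m) → Set
    P k = ringNeg f k ≡ signPow (toℕ k / m) (f (toℕ k mod m))
    signPow-index : ∀ b (i : Fin m) {k : Fin (m + m)} → toℕ k ≡ b * m + toℕ i →
                    signPow (toℕ k / m) (f (toℕ k mod m)) ≡ signPow b (f i)
    signPow-index b i {k} k≡ = cong₂ (λ e j → signPow e (f j)) quotient remainder
      where
      quotient : toℕ k / m ≡ b
      quotient = begin
        toℕ k / m                  ≡⟨ /-congˡ k≡ ⟩
        (b * m + toℕ i) / m        ≡⟨ +-distrib-/-∣ˡ (toℕ i) (divides b refl) ⟩
        b * m / m + toℕ i / m      ≡⟨ cong₂ _+_ (m*n/n≡m b m) (m<n⇒m/n≡0 (toℕ<n i)) ⟩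
        b + 0                      ≡⟨ +-identityʳ b ⟩
        b                          ∎
      remainder : toℕ k mod m ≡ i
      remainder = toℕ-injective (begin
        toℕ (toℕ k mod m)          ≡⟨ toℕ-mod (toℕ k) m ⟩
        toℕ k % m                  ≡⟨ %-congˡ k≡ ⟩
        (b * m + toℕ i) % m        ≡⟨ %-remove-+ˡ (toℕ i) (divides b refl) ⟩
        toℕ i % m                  ≡⟨ m<n⇒m%n≡m (toℕ<n i) ⟩
        toℕ i                      ∎)
    on-join : (x : Fin m ⊎ Fin m) → P (join m m x)
    on-join (inj₁ i) rewrite splitAt-↑ˡ m i m = sym (signPow-index 0 i (toℕ-↑ˡ i m))
    on-join (inj₂ i) rewrite splitAt-↑ʳ m m i =
      sym (signPow-index 1 i (trans (toℕ-↑ʳ m i) (cong (_+ toℕ i) (sym (*-identityˡ m)))))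

  periodicNeg-signPow : (p : ℕ) → periodicNeg m f p ≡ signPow (p / m) (f (p mod m))
  periodicNeg-signPow p = begin
    ringNeg f (p mod (m + m))                         ≡⟨ ringNeg-signPow (p mod (m + m)) ⟩
    signPow (toℕ k / m) (f (toℕ k mod m))             ≡⟨ cong₂ (λ e j → signPow e (f j)) quotient remainder ⟩
    signPow (p / m % 2) (f (p mod m))                 ≡⟨ signPow-cong (p / m % 2) (p / m) (f (p mod m)) (m%n%n≡m%n (p / m) 2) ⟩
    signPow (p / m) (f (p mod m))                     ∎
    where
    instance
      m+m≢0 : NonZero (m + m)
      m+m≢0 = double-nonZero m
      2*m≢0 : NonZero (2 * m)
      2*m≢0 = m*n≢0 2 m
    k : Fin (m + m)
    k = p mod (m + m)
    m+m≡2*m : m + m ≡ 2 * m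
    m+m≡2*m = cong (m +_) (sym (+-identityʳ m))
    quotient : toℕ k / m ≡ p / m % 2
    quotient = begin
      toℕ k / m             ≡⟨ /-congˡ (toℕ-mod p (m + m)) ⟩
      p % (m + m) / m       ≡⟨ /-congˡ (%-congʳ m+m≡2*m) ⟩
      p % (2 * m) / m       ≡⟨ m%[n*o]/o≡m/o%n p 2 m ⟩
      p / m % 2             ∎
    remainder : toℕ k mod m ≡ p mod m
    remainder = toℕ-injective (begin
      toℕ (toℕ k mod m)     ≡⟨ toℕ-mod (toℕ k) m ⟩
      toℕ k % m             ≡⟨ %-congˡ (toℕ-mod p (m + m)) ⟩
      p % (m + m) % m       ≡⟨ m∣n⇒o%n%m≡o%m m (m + m) p (divides 2 m+m≡2*m) ⟩
      p % m                 ≡⟨ toℕ-mod p m ⟨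
      toℕ (p mod m)         ∎)

window-≡⇒≡ : ∀ {A : Set} {a b : ℕ → A} {n i j} → window a n i ≡ window b n j →
             (k : Fin n) → a (i + toℕ k) ≡ b (j + toℕ k)
window-≡⇒≡ {a = a} {b} {i = i} {j} eq k = begin
  a (i + toℕ k)              ≡⟨ lookup∘tabulate (λ l → a (i + toℕ l)) k ⟨
  lookup (window a _ i) k    ≡⟨ cong (λ w → lookup w k) eq ⟩
  lookup (window b _ j) k    ≡⟨ lookup∘tabulate (λ l → b (j + toℕ l)) k ⟩
  b (j + toℕ k)              ∎

map-window : ∀ {A B : Set} (φ : A → B) {a : ℕ → A} {b : ℕ → B} → (∀ p → φ (a p) ≡ b p) →
             ∀ n i → map φ (window a n i) ≡ window b n i
map-window φ {a} φa≡b n i =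
  trans (sym (tabulate-∘ φ (λ k → a (i + toℕ k)))) (tabulate-cong (λ k → φa≡b (i + toℕ k)))

module Construction (q q' m : ℕ) .{{_ : NonZero q}} .{{_ : NonZero q'}} .{{_ : NonZero m}}
                    (q+q<q' : q + q < q') (s : Fin m → Fin q) where

  S'' T' : ℕ → Fin q'
  S'' = periodicNeg m (λ i → lift q' (s i))
  T' = periodicNeg m (tSeq q' m s)

  x+x<q' : (x : Fin q) → toℕ x + toℕ x < q'
  x+x<q' x = <-trans (+-mono-< (toℕ<n x) (toℕ<n x)) q+q<q'

  toℕ-lift : (x : Fin q) → toℕ (lift q' x) ≡ toℕ x
  toℕ-lift x = trans (toℕ-mod (toℕ x) q') (m<n⇒m%n≡m (≤-<-trans (m≤m+n (toℕ x) (toℕ x)) (x+x<q' x)))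

  abs-lift : (x : Fin q) → abs (lift q' x) ≡ toℕ x
  abs-lift x = abs-mod (toℕ x) (x+x<q' x)

  neg-lift≢lift : (x : Fin q) → toℕ x ≢ 0 → neg (lift q' x) ≢ lift q' x
  neg-lift≢lift x x≢0 = neg≢self (lift q' x)
    (subst (_≢ 0) (sym (toℕ-lift x)) x≢0) (subst (λ c → c + c < q') (sym (toℕ-lift x)) (x+x<q' x))

  tSeq-≢0 : ∀ i → toℕ (s i) ≢ 0 → tSeq q' m s i ≡ signPow (toℕ i + (m ∸ 1)) (lift q' (s i))
  tSeq-≢0 i ≢0 with toℕ (lift q' (s i)) ≟ 0
  ... | yes ≡0 = contradiction (trans (sym (toℕ-lift (s i))) ≡0) ≢0
  ... | no _   = cong (λ e → signPow e (lift q' (s i))) (+-∸-assoc (toℕ i) (>-nonZero⁻¹ m))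

  abs-tSeq-≡0 : ∀ i → toℕ (s i) ≡ 0 → abs (tSeq q' m s i) ≡ q
  abs-tSeq-≡0 i ≡0 with toℕ (lift q' (s i)) ≟ 0
  ... | yes _  = trans (abs-signPow (toℕ i + m ∸ 1) (q mod q')) (abs-mod q q+q<q')
  ... | no ≢0  = contradiction (trans (toℕ-lift (s i)) ≡0) ≢0

  abs-tSeq-≢0 : ∀ i → toℕ (s i) ≢ 0 → abs (tSeq q' m s i) ≡ toℕ (s i)
  abs-tSeq-≢0 i ≢0 =
    trans (cong abs (tSeq-≢0 i ≢0)) (trans (abs-signPow (toℕ i + (m ∸ 1)) _) (abs-lift (s i)))

  abs-S'' : ∀ p → abs (S'' p) ≡ toℕ (s (p mod m))
  abs-S'' p = trans (cong abs (periodicNeg-signPow m _ p)) (trans (abs-signPow (p / m) _) (abs-lift _))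

  abs-T' : ∀ p → abs (T' p) ≡ abs (tSeq q' m s (p mod m))
  abs-T' p = trans (cong abs (periodicNeg-signPow m _ p)) (abs-signPow (p / m) _)

  fold : Fin q' → Fin q
  fold v = abs v mod q

  fold-neg : ∀ v → fold (neg v) ≡ fold v
  fold-neg v = cong (_mod q) (abs-neg v)

  fold-S'' : ∀ p → fold (S'' p) ≡ periodic s p
  fold-S'' p = trans (cong (_mod q) (abs-S'' p)) (mod-toℕ _)

  fold-T' : ∀ p → fold (T' p) ≡ periodic s p
  fold-T' p with toℕ (s (p mod m)) ≟ 0
  ... | no ≢0  = trans (cong (_mod q) (trans (abs-T' p) (abs-tSeq-≢0 _ ≢0))) (mod-toℕ _)
  ... | yes ≡0 = toℕ-injective (begin
    toℕ (fold (T' p))   ≡⟨ toℕ-mod (abs (T' p)) q ⟩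
    abs (T' p) % q      ≡⟨ %-congˡ (trans (abs-T' p) (abs-tSeq-≡0 _ ≡0)) ⟩
    q % q               ≡⟨ n%n≡0 q ⟩
    0                   ≡⟨ ≡0 ⟨
    toℕ (s (p mod m))   ∎)

  -- Bracketed as toℕ i + (m ∸ 1), unlike tSeq, so that expT' (suc p) is suc (expT' p) within a period.
  expT' : ℕ → ℕ
  expT' p = p / m + (toℕ (p mod m) + (m ∸ 1))

  T'-≢0 : ∀ p → toℕ (s (p mod m)) ≢ 0 → T' p ≡ signPow (expT' p) (lift q' (s (p mod m)))
  T'-≢0 p ≢0 = begin
    T' p                                                   ≡⟨ periodicNeg-signPow m _ p ⟩
    signPow (p / m) (tSeq q' m s (p mod m))                ≡⟨ cong (signPow (p / m)) (tSeq-≢0 _ ≢0) ⟩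
    signPow (p / m) (signPow (toℕ (p mod m) + (m ∸ 1)) x)  ≡⟨ signPow-+ (p / m) _ x ⟨
    signPow (expT' p) x                                    ∎
    where
    x : Fin q'
    x = lift q' (s (p mod m))

  matching-entries : ∀ i j → S'' i ≡ T' j →
             toℕ (s (j mod m)) ≢ 0 × s (i mod m) ≡ s (j mod m) × i / m % 2 ≡ expT' j % 2
  matching-entries i j eq = ≢0 , same , parity
    where
    abs-eq : toℕ (s (i mod m)) ≡ abs (tSeq q' m s (j mod m))
    abs-eq = trans (sym (abs-S'' i)) (trans (cong abs eq) (abs-T' j))
    ≢0 : toℕ (s (j mod m)) ≢ 0
    ≢0 ≡0 = <⇒≢ (toℕ<n (s (i mod m))) (trans abs-eq (abs-tSeq-≡0 _ ≡0))
    same : s (i mod m) ≡ s (j mod m)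
    same = toℕ-injective (trans abs-eq (abs-tSeq-≢0 _ ≢0))
    x : Fin q'
    x = lift q' (s (j mod m))
    parity : i / m % 2 ≡ expT' j % 2
    parity = signPow-parity (i / m) (expT' j) x (neg-lift≢lift _ ≢0) (begin
      signPow (i / m) x                         ≡⟨ cong (signPow (i / m) ∘ lift q') same ⟨
      signPow (i / m) (lift q' (s (i mod m)))   ≡⟨ periodicNeg-signPow m _ i ⟨
      S'' i                                     ≡⟨ eq ⟩
      T' j                                      ≡⟨ T'-≢0 j ≢0 ⟩
      signPow (expT' j) x                       ∎)

  fold-map-neg : ∀ {n} (v : Vec (Fin q') n) → map fold (map neg v) ≡ map fold v
  fold-map-neg v = trans (sym (map-∘ fold neg v)) (map-cong fold-neg v)

  fold-reverse-T' : ∀ n j → map fold (reverse (window T' n j)) ≡ reverse (window (periodic s) n j)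
  fold-reverse-T' n j = trans (map-reverse fold (window T' n j)) (cong reverse (map-window fold fold-T' n j))

  ≢-folding-to-reverse : ∀ {n} → (∀ i j → window (periodic s) n i ≢ reverse (window (periodic s) n j)) →
                         ∀ i j {v} → map fold v ≡ reverse (window (periodic s) n j) → window S'' n i ≢ v
  ≢-folding-to-reverse {n} orientable i j {v} fold-v eq = orientable i j (begin
    window (periodic s) n i             ≡⟨ map-window fold fold-S'' n i ⟨
    map fold (window S'' n i)           ≡⟨ cong (map fold) eq ⟩
    map fold v                          ≡⟨ fold-v ⟩
    reverse (window (periodic s) n j)   ∎)

  module _ (s₀ : toℕ (periodic s 0) ≡ 0) where

    s≢0⇒%m≢0 : ∀ p → toℕ (s (p mod m)) ≢ 0 → p % m ≢ 0
    s≢0⇒%m≢0 p ≢0 p%m≡0 = ≢0 (trans (cong (toℕ ∘ s) p-mod≡0-mod) s₀)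
      where
      p-mod≡0-mod : p mod m ≡ 0 mod m
      p-mod≡0-mod = toℕ-injective (begin
        toℕ (p mod m)   ≡⟨ toℕ-mod p m ⟩
        p % m           ≡⟨ p%m≡0 ⟩
        0               ≡⟨ m<n⇒m%n≡m (>-nonZero⁻¹ m) ⟨
        0 % m           ≡⟨ toℕ-mod 0 m ⟨
        toℕ (0 mod m)   ∎)

    expT'-suc : ∀ p → suc p % m ≢ 0 → expT' (suc p) ≡ suc (expT' p)
    expT'-suc p ≢0 with suc-/-%≢0 p m ≢0
    ... | quotient , remainder = begin
      suc p / m + (toℕ (suc p mod m) + (m ∸ 1))   ≡⟨ cong₂ (λ a b → a + (b + (m ∸ 1))) quotient toℕ-suc ⟩
      p / m + suc (toℕ (p mod m) + (m ∸ 1))       ≡⟨ +-suc (p / m) _ ⟩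
      suc (expT' p)                               ∎
      where
      toℕ-suc : toℕ (suc p mod m) ≡ suc (toℕ (p mod m))
      toℕ-suc = trans (toℕ-mod (suc p) m) (trans remainder (cong suc (sym (toℕ-mod p m))))

    no-adjacent-matches : ∀ i j → S'' i ≡ T' j → S'' (suc i) ≡ T' (suc j) → ⊥
    no-adjacent-matches i j eq eq₁ with matching-entries i j eq | matching-entries (suc i) (suc j) eq₁
    ... | _ , _ , parity | ≢0 , same , parity₁ = %2≢suc%2 (expT' j) (begin
      expT' j % 2         ≡⟨ parity ⟨
      i / m % 2           ≡⟨ cong (_% 2) (proj₁ (suc-/-%≢0 i m suc-i%m≢0)) ⟨
      suc i / m % 2       ≡⟨ parity₁ ⟩
      expT' (suc j) % 2   ≡⟨ cong (_% 2) (expT'-suc j (s≢0⇒%m≢0 (suc j) ≢0)) ⟩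
      suc (expT' j) % 2   ∎)
      where
      suc-i%m≢0 : suc i % m ≢ 0
      suc-i%m≢0 = s≢0⇒%m≢0 (suc i) (subst (λ x → toℕ x ≢ 0) (sym same) ≢0)

corollary3p17 : (q q' n m : ℕ) .{{_ : NonZero q}} .{{_ : NonZero q'}} .{{_ : NonZero m}} →
    2 * q + 1 ≤ q' → 4 < 2 * q + 1 → 1 < n →
    (s : Fin m → Fin q) → IsOS q n m s → toℕ (periodic s 0) ≡ 0 →
    SDisjoint n (periodicNeg m (λ i → lift q' (s i))) (periodicNeg m (tSeq q' m s))
corollary3p17 q q' n@(suc (suc _)) m 2q+1≤q' _ (s≤s (s≤s z≤n)) s (_ , orientable) s₀ i j =
  ≢-direct ,
  ≢-folding-to-reverse orientable i j (fold-reverse-T' n j) ,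
  ≢-folding-to-reverse orientable i j (trans (fold-map-neg _) (fold-reverse-T' n j))
  where
  q+q<q' : q + q < q'
  q+q<q' = subst (_≤ q') (trans (+-comm (2 * q) 1) (cong (λ k → suc (q + k)) (+-identityʳ q))) 2q+1≤q'
  open Construction q q' m q+q<q' s
  ≢-direct : window S'' n i ≢ window T' n j
  ≢-direct eq = no-adjacent-matches s₀ i j
    (subst₂ (λ a b → S'' a ≡ T' b) (+-identityʳ i) (+-identityʳ j) (entry zero))
    (subst₂ (λ a b → S'' a ≡ T' b) (+-comm i 1) (+-comm j 1) (entry (suc zero)))
    where
    entry : (k : Fin n) → S'' (i + toℕ k) ≡ T' (j + toℕ k)
    entry = window-≡⇒≡ {a = S''} {b = T'} eq
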